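{- Let $P$ be a weakly ranked, finite, bounded poset of weak rank at most $6$. Then the coefficient sequence of its Chow polynomial $H_P(t)$ is log-concave, i.e. writing $H_P(t)=\sum_{i=0}^{d}h_it^i$, one has $h_i^2\ge h_{i-1}h_{i+1}$ for all $1\le i\le d-1$.
   Context: A weak rank function on a poset $P$ is a function $\rho:P\times P\to\mathbb{N}$, $(x,y)\mapsto\rho_{x,y}$, with $\rho_{x,y}>0$ iff $x<y$ and $\rho_{x,y}=\rho_{x,z}+\rho_{z,y}$ for $x\le z\le y$; $P$ is bounded with least element $\hat0$, greatest element $\hat1$, $\rho(x)=\rho_{\hat0,x}$, and the weak rank of $P$ is $\rho(\hat1)$. The Chow polynomial is $$H_P(t)=\sum_{s\ge 0}\ \sum_{\hat0=p_0<p_1<\cdots<p_s\le \hat1}\ \prod_{i=1}^{s}\frac{t\left(t^{\rho(p_i)-\rho(p_{i-1})-1}-1\right)}{t-1}.$$ -}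

module Defs where

open import Data.Nat using (ℕ; zero; suc; _+_; _*_; _∸_; _≤_; _<_; _<ᵇ_)
open import Data.Bool using (if_then_else_)
open import Data.Fin using (Fin)
import Data.Fin.Properties as FinP
open import Data.List using (List; []; _∷_; map; foldr; upTo; allFin; concatMap)
open import Data.Nat.ListAction using (sum)
open import Data.Product using (_×_)
open import Relation.Nullary using (¬_; Dec; yes; no)
open import Relation.Nullary.Decidable using (_×-dec_; ¬?)
open import Relation.Binary.PropositionalEquality using (_≡_)
open import Function.Bundles using (_⇔_)

record WeaklyRankedPoset (n : ℕ) : Set₁ where
  field
    _≤P_     : Fin n → Fin n → Set
    ≤P-dec   : (x y : Fin n) → Dec (x ≤P y)
    ≤P-refl  : ∀ x → x ≤P x
    ≤P-antisym : ∀ {x y} → x ≤P y → y ≤P x → x ≡ y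
    ≤P-trans : ∀ {x y z} → x ≤P y → y ≤P z → x ≤P z
    bot      : Fin n
    top      : Fin n
    bot-least    : ∀ x → bot ≤P x
    top-greatest : ∀ x → x ≤P top
    ρ        : Fin n → Fin n → ℕ
    ρ-pos    : ∀ x y → (0 < ρ x y) ⇔ (x ≤P y × ¬ (x ≡ y))
    ρ-add    : ∀ x z y → x ≤P z → z ≤P y → ρ x y ≡ ρ x z + ρ z y

  _<P_ : Fin n → Fin n → Set
  x <P y = x ≤P y × ¬ (x ≡ y)

  <P-dec : (x y : Fin n) → Dec (x <P y)
  <P-dec x y = ≤P-dec x y ×-dec ¬? (x FinP.≟ y)

  rk : Fin n → ℕ
  rk x = ρ bot x

  weakRank : ℕ
  weakRank = rk top

-- Polynomials with natural-number coefficients, as coefficient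
-- functions ℕ → ℕ (coefficient of t^i).

Poly : Set
Poly = ℕ → ℕ

0ₚ : Poly
0ₚ _ = 0

1ₚ : Poly
1ₚ zero    = 1
1ₚ (suc _) = 0

_+ₚ_ : Poly → Poly → Poly
(f +ₚ g) i = f i + g i

_*ₚ_ : Poly → Poly → Poly
(f *ₚ g) k = sum (map (λ j → f j * g (k ∸ j)) (upTo (suc k)))

sumₚ : List Poly → Poly
sumₚ = foldr _+ₚ_ 0ₚ

-- The polynomial t (t^{k-1} - 1)/(t - 1) = t + t² + … + t^{k-1}
-- (for k ≥ 1; it is 0 for k = 1).  Coefficient of t^i is 1 iff 1 ≤ i ≤ k-1.
factor : ℕ → Poly
factor k zero    = 0
factor k (suc i) = if suc i <ᵇ k then 1 else 0

module _ {n : ℕ} (P : WeaklyRankedPoset n) where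
  open WeaklyRankedPoset P

  lists : ℕ → List (List (Fin n))
  lists zero    = [] ∷ []
  lists (suc s) = concatMap (λ x → map (x ∷_) (lists s)) (allFin n)

  chainWeight : Fin n → List (Fin n) → Poly
  chainWeight x []       = 1ₚ
  chainWeight x (y ∷ ys) with <P-dec x y | ≤P-dec y top
  ... | yes _ | yes _ = factor (rk y ∸ rk x) *ₚ chainWeight y ys
  ... | _     | _     = 0ₚ

  -- H_P(t) = Σ_{s ≥ 0} Σ_{0̂ = p_0 < p_1 < … < p_s ≤ 1̂} Π factors.
  -- A strict chain in a poset with n elements has s ≤ n (in fact s < n),
  -- so the sum over s may be truncated at s = n.
  chowPoly : Poly
  chowPoly = sumₚ (map (λ s → sumₚ (map (chainWeight bot) (lists s))) (upTo (suc n)))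

-- log-concavity of a coefficient sequence (coefficients vanish beyond
-- the degree, so requiring it for all i ≥ 1 is the same as for 1 ≤ i ≤ d-1)
LogConcave : Poly → Set
LogConcave h = ∀ i → h i * h (suc (suc i)) ≤ h (suc i) * h (suc i)

-- When the weak rank r is at most 6, a chain 0̂ < p₁ < ⋯ < p_s contributes to H_P only if all its
-- rank gaps are at least 2, since the factor t + ⋯ + t^{k-1} vanishes for k ≤ 1; so only chains with
-- s ≤ 3 count. Every coefficient h_j is then a sum over triples (x, y, z) of a number depending only
-- on the ranks of x, y, z and on which of 0̂ < x, x < y, y < z hold, provided a chain of length s < 3
-- is recorded at the triple obtained by appending 1̂. A chain ending below 1̂ and its extension by 1̂
-- land on the same triple and together are palindromic of degree r - 1, so comparing these numbers
-- triple by triple, a finite computation, shows h_j = h_{r-1-j}, and h₁ ≤ h₂ when r ≥ 4.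
-- Moreover h₀ = 1 and h₂ ≤ h₁²: the chains counted by h₂ are the elements of rank ≥ 3 and the pairs
-- x < y with both gaps ≥ 2, and these inject into the pairs of elements of rank ≥ 2. A palindromic
-- sequence of degree at most 5 with these properties is log-concave.

module Submission where

open import Defs
open import Algebra.Properties.CommutativeSemigroup using (interchange)
open import Data.Bool using (Bool; true; false; if_then_else_; T; _∧_)
import Data.Bool.Properties as Bool
open import Data.Empty using (⊥; ⊥-elim)
open import Data.Fin using (Fin; zero; suc)
import Data.Fin.Properties as Fin
open import Data.List using (List; []; _∷_; _++_; map; concatMap; upTo; allFin; tabulate; length; cartesianProduct)
open import Data.List.Properties using (map-++; map-∘; map-upTo; map-tabulate)
open import Data.List.Membership.Propositional using (_∈_)
open import Data.List.Membership.Propositional.Properties using (∈-upTo⁺; ∈-upTo⁻; ∈-cartesianProduct⁺)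
open import Data.List.Relation.Unary.All as All using (All)
open import Data.List.Relation.Unary.Any using (here; there)
open import Data.Nat using (ℕ; zero; suc; _≤_; _+_; _*_; _∸_; _<_; _<ᵇ_; _≡ᵇ_; z≤n; s≤s; z<s; s<s; >-nonZero⁻¹)
open import Data.Nat.ListAction using (sum)
open import Data.Nat.ListAction.Properties using (sum-++)
open import Data.Nat.Properties
open import Data.Product using (_×_; _,_; proj₁; proj₂)
open import Function using (_∘_; id; Equivalence)
open import Relation.Binary.PropositionalEquality
open import Relation.Nullary using (Dec; yes; no; does; proof; ¬_)
open import Relation.Nullary.Decidable using (from-yes; dec-true; dec-false; T?; _×-dec_; _→-dec_)
open import Relation.Nullary.Reflects using (det; fromEquivalence)

private variable
  A B : Set

∑ : List A → (A → ℕ) → ℕ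
∑ xs f = sum (map f xs)

when : Bool → ℕ → ℕ
when b c = if b then c else 0

when-∧ : ∀ a b c → when (a ∧ b) c ≡ when a (when b c)
when-∧ true  b c = refl
when-∧ false b c = refl

when-vanish : ∀ b {c} → (T b → c ≡ 0) → when b c ≡ 0
when-vanish true  c≡0 = c≡0 _
when-vanish false _   = refl

∑-cong : ∀ xs {f g : A → ℕ} → (∀ x → f x ≡ g x) → ∑ xs f ≡ ∑ xs g
∑-cong []       _   = refl
∑-cong (x ∷ xs) f≗g = cong₂ _+_ (f≗g x) (∑-cong xs f≗g)

∑-zero : ∀ xs {f : A → ℕ} → (∀ {x} → x ∈ xs → f x ≡ 0) → ∑ xs f ≡ 0
∑-zero []       _   = refl
∑-zero (x ∷ xs) f≗0 = cong₂ _+_ (f≗0 (here refl)) (∑-zero xs (f≗0 ∘ there))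

∑-mono-≤ : ∀ xs {f g : A → ℕ} → (∀ x → f x ≤ g x) → ∑ xs f ≤ ∑ xs g
∑-mono-≤ []       _   = z≤n
∑-mono-≤ (x ∷ xs) f≤g = +-mono-≤ (f≤g x) (∑-mono-≤ xs f≤g)

∑-distrib-+ : ∀ xs (f g : A → ℕ) → ∑ xs (λ x → f x + g x) ≡ ∑ xs f + ∑ xs g
∑-distrib-+ []       f g = refl
∑-distrib-+ (x ∷ xs) f g = trans (cong (f x + g x +_) (∑-distrib-+ xs f g))
  (interchange +-commutativeSemigroup (f x) (g x) (∑ xs f) (∑ xs g))

∑-distribˡ-* : ∀ xs c (f : A → ℕ) → c * ∑ xs f ≡ ∑ xs (λ x → c * f x)
∑-distribˡ-* []       c f = *-zeroʳ c
∑-distribˡ-* (x ∷ xs) c f = trans (*-distribˡ-+ c (f x) (∑ xs f)) (cong (c * f x +_) (∑-distribˡ-* xs c f))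

∑-distribʳ-* : ∀ xs c (f : A → ℕ) → ∑ xs f * c ≡ ∑ xs (λ x → f x * c)
∑-distribʳ-* []       c f = refl
∑-distribʳ-* (x ∷ xs) c f = trans (*-distribʳ-+ c (f x) (∑ xs f)) (cong (f x * c +_) (∑-distribʳ-* xs c f))

∑-++ : ∀ xs ys (f : A → ℕ) → ∑ (xs ++ ys) f ≡ ∑ xs f + ∑ ys f
∑-++ xs ys f = trans (cong sum (map-++ f xs ys)) (sum-++ (map f xs) (map f ys))

∑-map : ∀ xs (g : A → B) (f : B → ℕ) → ∑ (map g xs) f ≡ ∑ xs (f ∘ g)
∑-map xs g f = cong sum (sym (map-∘ {g = f} {f = g} xs))

∑-concatMap : ∀ xs (g : A → List B) (f : B → ℕ) → ∑ (concatMap g xs) f ≡ ∑ xs (λ x → ∑ (g x) f)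
∑-concatMap []       g f = refl
∑-concatMap (x ∷ xs) g f = trans (∑-++ (g x) (concatMap g xs) f) (cong (∑ (g x) f +_) (∑-concatMap xs g f))

sum-tabulate-zero : ∀ {n} (f : Fin n → ℕ) → (∀ y → f y ≡ 0) → sum (tabulate f) ≡ 0
sum-tabulate-zero {zero}  f f≗0 = refl
sum-tabulate-zero {suc n} f f≗0 = cong₂ _+_ (f≗0 zero) (sum-tabulate-zero (f ∘ suc) (f≗0 ∘ suc))

sum-tabulate-single : ∀ {n} (f : Fin n → ℕ) t → (∀ y → y ≢ t → f y ≡ 0) → sum (tabulate f) ≡ f t
sum-tabulate-single f zero f≗0 =
  trans (cong (f zero +_) (sum-tabulate-zero (f ∘ suc) (λ y → f≗0 (suc y) λ ()))) (+-identityʳ (f zero))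
sum-tabulate-single f (suc t) f≗0 =
  cong₂ _+_ (f≗0 zero λ ()) (sum-tabulate-single (f ∘ suc) t (λ y y≢t → f≗0 (suc y) (y≢t ∘ Fin.suc-injective)))

∑-allFin-single : ∀ {n} (f : Fin n → ℕ) t → (∀ y → y ≢ t → f y ≡ 0) → ∑ (allFin n) f ≡ f t
∑-allFin-single f t f≗0 = trans (cong sum (map-tabulate id f)) (sum-tabulate-single f t f≗0)

∑-upTo-suc : ∀ m (f : ℕ → ℕ) → ∑ (upTo (suc m)) f ≡ f 0 + ∑ (upTo m) (f ∘ suc)
∑-upTo-suc m f = cong (f 0 +_) (trans (cong (λ xs → ∑ xs f) (sym (map-upTo suc m))) (∑-map (upTo m) suc f))

∑-upTo-truncate : ∀ {k m} (f : ℕ → ℕ) → (∀ i → k ≤ i → f i ≡ 0) → k ≤ m → ∑ (upTo m) f ≡ ∑ (upTo k) f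
∑-upTo-truncate {zero}  {m}     f f≗0 _         = ∑-zero (upTo m) (λ {i} _ → f≗0 i z≤n)
∑-upTo-truncate {suc k} {suc m} f f≗0 (s≤s k≤m) = begin
  ∑ (upTo (suc m)) f          ≡⟨ ∑-upTo-suc m f ⟩
  f 0 + ∑ (upTo m) (f ∘ suc)  ≡⟨ cong (f 0 +_) (∑-upTo-truncate (f ∘ suc) (λ i k≤i → f≗0 (suc i) (s≤s k≤i)) k≤m) ⟩
  f 0 + ∑ (upTo k) (f ∘ suc)  ≡⟨ ∑-upTo-suc k f ⟨
  ∑ (upTo (suc k)) f          ∎
  where open ≡-Reasoning

does-sound : (a? : Dec A) → T (does a?) → A
does-sound (yes a) _ = a

no-three-distinct : ∀ {n} → n ≤ 2 → (a b c : Fin n) → a ≢ b → b ≢ c → a ≢ c → ⊥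
no-three-distinct _ zero       zero       _          a≢b _   _   = a≢b refl
no-three-distinct _ zero       (suc zero) zero       _   _   a≢c = a≢c refl
no-three-distinct _ zero       (suc zero) (suc zero) _   b≢c _   = b≢c refl
no-three-distinct _ (suc zero) zero       zero       _   b≢c _   = b≢c refl
no-three-distinct _ (suc zero) zero       (suc zero) _   _   a≢c = a≢c refl
no-three-distinct _ (suc zero) (suc zero) _          a≢b _   _   = a≢b refl
no-three-distinct {suc (suc (suc _))} (s≤s (s≤s ())) _ _ _ _ _ _

sumₚ-map : ∀ (F : A → Poly) xs i → sumₚ (map F xs) i ≡ ∑ xs (λ a → F a i)
sumₚ-map F []       i = refl
sumₚ-map F (x ∷ xs) i = cong (F x i +_) (sumₚ-map F xs i)

*ₚ-congʳ : ∀ f {g g′ : Poly} → (∀ i → g i ≡ g′ i) → ∀ k → (f *ₚ g) k ≡ (f *ₚ g′) k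
*ₚ-congʳ f g≗g′ k = ∑-cong (upTo (suc k)) (λ i → cong (f i *_) (g≗g′ (k ∸ i)))

*ₚ-when : ∀ f g b k → (f *ₚ (λ i → when b (g i))) k ≡ when b ((f *ₚ g) k)
*ₚ-when f g true  k = refl
*ₚ-when f g false k = ∑-zero (upTo (suc k)) (λ {i} _ → *-zeroʳ (f i))

*ₚ-zeroˡ : ∀ {f} g → (∀ i → f i ≡ 0) → ∀ k → (f *ₚ g) k ≡ 0
*ₚ-zeroˡ g f≗0 k = ∑-zero (upTo (suc k)) (λ {i} _ → cong (_* g (k ∸ i)) (f≗0 i))

*ₚ-zeroʳ : ∀ f {g} → (∀ i → g i ≡ 0) → ∀ k → (f *ₚ g) k ≡ 0
*ₚ-zeroʳ f g≗0 k = ∑-zero (upTo (suc k)) (λ {i} _ → trans (cong (f i *_) (g≗0 (k ∸ i))) (*-zeroʳ (f i)))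

*ₚ-identityʳ : ∀ f k → (f *ₚ 1ₚ) k ≡ f k
*ₚ-identityʳ f zero    = trans (+-identityʳ (f 0 * 1)) (*-identityʳ (f 0))
*ₚ-identityʳ f (suc k) =
  trans (∑-upTo-suc (suc k) (λ i → f i * 1ₚ (suc k ∸ i))) (cong₂ _+_ (*-zeroʳ (f 0)) (*ₚ-identityʳ (f ∘ suc) k))

*ₚ-vanish-above : ∀ {a b} f g → (∀ i → a ≤ i → f i ≡ 0) → (∀ i → b ≤ i → g i ≡ 0) →
                  ∀ k → a + b ≤ suc k → (f *ₚ g) k ≡ 0
*ₚ-vanish-above {a} {b} f g f≗0 g≗0 k a+b≤1+k = ∑-zero (upTo (suc k)) (λ {i} _ → term i)
  where
  term : ∀ i → f i * g (k ∸ i) ≡ 0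
  term i with a ≤? i
  ... | yes a≤i = cong (_* g (k ∸ i)) (f≗0 i a≤i)
  ... | no  a≰i = trans (cong (f i *_) (g≗0 (k ∸ i) (m+n≤o⇒m≤o∸n b (≤-pred b+i<1+k)))) (*-zeroʳ (f i))
    where
    open ≤-Reasoning
    b+i<1+k : b + i < suc k
    b+i<1+k = begin-strict
      b + i  <⟨ +-monoʳ-< b (≰⇒> a≰i) ⟩
      b + a  ≡⟨ +-comm b a ⟩
      a + b  ≤⟨ a+b≤1+k ⟩
      suc k  ∎

*ₚ-vanish-below : ∀ {a b} f g → (∀ i → i < a → f i ≡ 0) → (∀ i → i < b → g i ≡ 0) →
                  ∀ k → k < a + b → (f *ₚ g) k ≡ 0
*ₚ-vanish-below {a} {b} f g f≗0 g≗0 k k<a+b = ∑-zero (upTo (suc k)) (λ i∈ → term _ (≤-pred (∈-upTo⁻ i∈)))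
  where
  term : ∀ i → i ≤ k → f i * g (k ∸ i) ≡ 0
  term i i≤k with i <? a
  ... | yes i<a = cong (_* g (k ∸ i)) (f≗0 i i<a)
  ... | no  i≮a = trans (cong (f i *_) (g≗0 (k ∸ i) k∸i<b)) (*-zeroʳ (f i))
    where
    k∸i<b : k ∸ i < b
    k∸i<b = subst (k ∸ i <_) (m+n∸m≡n i b)
      (∸-monoˡ-< (<-≤-trans k<a+b (+-monoˡ-≤ b (≮⇒≥ i≮a))) i≤k)

<⇒<ᵇ≡true : ∀ {m n} → m < n → (m <ᵇ n) ≡ true
<⇒<ᵇ≡true = Equivalence.to Bool.T-≡ ∘ <⇒<ᵇ

<ᵇ≡true⇒< : ∀ {m n} → (m <ᵇ n) ≡ true → m < n
<ᵇ≡true⇒< {m} {n} = <ᵇ⇒< m n ∘ Equivalence.from Bool.T-≡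

factor-vanish-above : ∀ k i → k ≤ i → factor k i ≡ 0
factor-vanish-above k zero    _   = refl
factor-vanish-above k (suc i) k≤i with suc i <ᵇ k in eq
... | true  = ⊥-elim (<⇒≱ (<ᵇ≡true⇒< eq) k≤i)
... | false = refl

factor-vanish-small : ∀ k → k ≤ 1 → ∀ i → factor k i ≡ 0
factor-vanish-small k k≤1 zero    = refl
factor-vanish-small k k≤1 (suc i) = factor-vanish-above k (suc i) (≤-trans k≤1 (s≤s z≤n))

factor-monoˡ-≤ : ∀ {a b} → a ≤ b → ∀ i → factor a i ≤ factor b i
factor-monoˡ-≤         a≤b zero    = z≤n
factor-monoˡ-≤ {a} {b} a≤b (suc i) with suc i <ᵇ a in eq
... | false = z≤n
... | true  rewrite <⇒<ᵇ≡true {suc i} {b} (<-≤-trans (<ᵇ≡true⇒< eq) a≤b) = ≤-refl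

factor-antitoneʳ : ∀ k i → factor k (suc (suc i)) ≤ factor k (suc i)
factor-antitoneʳ k i with suc (suc i) <ᵇ k in eq
... | false = z≤n
... | true  rewrite <⇒<ᵇ≡true {suc i} {k} (<-trans (n<1+n (suc i)) (<ᵇ≡true⇒< eq)) = ≤-refl

factorProduct : List ℕ → Poly
factorProduct []       = 1ₚ
factorProduct (a ∷ as) = factor a *ₚ factorProduct as

factorProduct-vanish-above : ∀ as j → sum as < j → factorProduct as j ≡ 0
factorProduct-∷-vanish-above : ∀ a as j → a + sum as ≤ j → factorProduct (a ∷ as) j ≡ 0

factorProduct-vanish-above []       (suc j) _    = refl
factorProduct-vanish-above (a ∷ as) j       Σ<j = factorProduct-∷-vanish-above a as j (<⇒≤ Σ<j)

factorProduct-∷-vanish-above a as j Σ≤j =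
  *ₚ-vanish-above (factor a) (factorProduct as) (factor-vanish-above a) (factorProduct-vanish-above as) j
    (subst (_≤ suc j) (sym (+-suc a (sum as))) (s≤s Σ≤j))

factorProduct-vanish-below : ∀ as j → j < length as → factorProduct as j ≡ 0
factorProduct-vanish-below (a ∷ as) j j<len =
  *ₚ-vanish-below (factor a) (factorProduct as) (λ { zero _ → refl ; (suc _) (s≤s ()) })
    (factorProduct-vanish-below as) j j<len

factorProduct-vanish-long : ∀ as j → sum as < 2 * length as → factorProduct as j ≡ 0
factorProduct-vanish-long (a ∷ as) j Σ<2len with a ≤? 1
... | yes a≤1 = *ₚ-zeroˡ (factorProduct as) (factor-vanish-small a a≤1) j
... | no  a≰1 = *ₚ-zeroʳ (factor a) (λ i → factorProduct-vanish-long as i (+-cancelˡ-< 2 _ _ 2+Σ<2+2len)) j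
  where
  open ≤-Reasoning
  2+Σ<2+2len : 2 + sum as < 2 + 2 * length as
  2+Σ<2+2len = begin-strict
    2 + sum as               ≤⟨ +-monoˡ-≤ (sum as) (≰⇒> a≰1) ⟩
    a + sum as               <⟨ Σ<2len ⟩
    2 * suc (length as)      ≡⟨ *-suc 2 (length as) ⟩
    2 + 2 * length as        ∎

factorProduct-[_] : ∀ a j → factorProduct (a ∷ []) j ≡ factor a j
factorProduct-[ a ] j = *ₚ-identityʳ (factor a) j

factorProduct-pair-2 : ∀ a b → factorProduct (a ∷ b ∷ []) 2 ≡ factor a 1 * factor b 1
factorProduct-pair-2 a b = trans (*ₚ-congʳ (factor a) (factorProduct-[ b ]) 2)
  (trans (cong (factor a 1 * factor b 1 +_) (trans (+-identityʳ _) (*-zeroʳ (factor a 2)))) (+-identityʳ _))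

-- Log-concavity of short palindromic sequences

Palindromic : ℕ → Poly → Set
Palindromic r h = ∀ i → i < r → h i ≡ h (r ∸ suc i)

palindromic-from-≤ : ∀ r (h : Poly) → (∀ i → i < r → h i ≤ h (r ∸ suc i)) → Palindromic r h
palindromic-from-≤ (suc r) h le i i<r = ≤-antisym (le i i<r)
  (subst (λ k → h (r ∸ i) ≤ h k) (m∸[m∸n]≡n (≤-pred i<r)) (le (r ∸ i) (s≤s (m∸n≤m r i))))

LogConcave-cong : ∀ {f g} → (∀ j → f j ≡ g j) → LogConcave g → LogConcave f
LogConcave-cong f≗g lc i = subst₂ _≤_
  (sym (cong₂ _*_ (f≗g i) (f≗g (suc (suc i))))) (sym (cong₂ _*_ (f≗g (suc i)) (f≗g (suc i)))) (lc i)

m≤m*m : ∀ m → m ≤ m * m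
m≤m*m zero    = z≤n
m≤m*m (suc m) = m≤m*n (suc m) (suc m)

module _ {h : Poly} (h₀≡1 : h 0 ≡ 1) (h₂≤h₁² : h 2 ≤ h 1 * h 1) where
  open ≤-Reasoning

  private
    *-h₀ : ∀ {a b} → h 0 ≡ b → a * b ≡ a
    *-h₀ {a} h₀≡b = trans (cong (a *_) (trans (sym h₀≡b) h₀≡1)) (*-identityʳ a)

  logConcave-interior : ∀ r i → Palindromic r h → (4 ≤ r → h 1 ≤ h 2) → 3 + i < r → r ≤ 6 →
                        h (1 + i) * h (3 + i) ≤ h (2 + i) * h (2 + i)
  logConcave-interior 4 0 pal uni _ _ = begin
    h 1 * h 3  ≡⟨ *-h₀ (pal 0 z<s) ⟩
    h 1        ≤⟨ m≤m*m (h 1) ⟩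
    h 1 * h 1  ≡⟨ cong₂ _*_ (pal 1 (s<s z<s)) (pal 1 (s<s z<s)) ⟩
    h 2 * h 2  ∎
  logConcave-interior 5 0 pal uni _ _ = begin
    h 1 * h 3  ≡⟨ cong (h 1 *_) (pal 1 (s<s z<s)) ⟨
    h 1 * h 1  ≤⟨ *-mono-≤ (uni (s≤s (s≤s (s≤s (s≤s z≤n))))) (uni (s≤s (s≤s (s≤s (s≤s z≤n))))) ⟩
    h 2 * h 2  ∎
  logConcave-interior 6 0 pal uni _ _ = begin
    h 1 * h 3  ≤⟨ *-monoˡ-≤ (h 3) (uni (s≤s (s≤s (s≤s (s≤s z≤n))))) ⟩
    h 2 * h 3  ≡⟨ cong (h 2 *_) (pal 2 (s<s (s<s z<s))) ⟨
    h 2 * h 2  ∎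
  logConcave-interior 5 1 pal uni _ _ = begin
    h 2 * h 4  ≡⟨ *-h₀ (pal 0 z<s) ⟩
    h 2        ≤⟨ h₂≤h₁² ⟩
    h 1 * h 1  ≡⟨ cong₂ _*_ (pal 1 (s<s z<s)) (pal 1 (s<s z<s)) ⟩
    h 3 * h 3  ∎
  logConcave-interior 6 1 pal uni _ _ = begin
    h 2 * h 4  ≡⟨ cong (h 2 *_) (pal 1 (s<s z<s)) ⟨
    h 2 * h 1  ≤⟨ *-monoʳ-≤ (h 2) (uni (s≤s (s≤s (s≤s (s≤s z≤n))))) ⟩
    h 2 * h 2  ≡⟨ cong₂ _*_ (pal 2 (s<s (s<s z<s))) (pal 2 (s<s (s<s z<s))) ⟩
    h 3 * h 3  ∎
  logConcave-interior 6 2 pal uni _ _ = begin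
    h 3 * h 5  ≡⟨ *-h₀ (pal 0 z<s) ⟩
    h 3        ≡⟨ pal 2 (s<s (s<s z<s)) ⟨
    h 2        ≤⟨ h₂≤h₁² ⟩
    h 1 * h 1  ≡⟨ cong₂ _*_ (pal 1 (s<s z<s)) (pal 1 (s<s z<s)) ⟩
    h 4 * h 4  ∎
  logConcave-interior 0 _ _ _ () _
  logConcave-interior 1 _ _ _ (s≤s ()) _
  logConcave-interior 2 _ _ _ (s≤s (s≤s ())) _
  logConcave-interior 3 _ _ _ (s≤s (s≤s (s≤s ()))) _
  logConcave-interior 4 (suc _) _ _ (s≤s (s≤s (s≤s (s≤s ())))) _
  logConcave-interior 5 (suc (suc _)) _ _ (s≤s (s≤s (s≤s (s≤s (s≤s ()))))) _
  logConcave-interior 6 (suc (suc (suc _))) _ _ (s≤s (s≤s (s≤s (s≤s (s≤s (s≤s ())))))) _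
  logConcave-interior (suc (suc (suc (suc (suc (suc (suc _))))))) _ _ _ _ (s≤s (s≤s (s≤s (s≤s (s≤s (s≤s ()))))))

  logConcave-of-shape : ∀ r → r ≤ 6 → (∀ j → 1 ≤ j → r ≤ j → h j ≡ 0) →
                        Palindromic r h → (4 ≤ r → h 1 ≤ h 2) → LogConcave h
  logConcave-of-shape r r≤6 vanish pal uni zero = begin
    h 0 * h 2  ≡⟨ trans (cong (_* h 2) h₀≡1) (*-identityˡ (h 2)) ⟩
    h 2        ≤⟨ h₂≤h₁² ⟩
    h 1 * h 1  ∎
  logConcave-of-shape r r≤6 vanish pal uni (suc i) with r ≤? 3 + i
  ... | yes r≤3+i = ≤-trans (≤-reflexive (trans (cong (h (suc i) *_) (vanish (3 + i) (s≤s z≤n) r≤3+i)) (*-zeroʳ (h (suc i))))) z≤n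
  ... | no  r≰3+i = logConcave-interior r i pal uni (≰⇒> r≰3+i) r≤6

Profile : Set
Profile = (ℕ × ℕ × ℕ) × (Bool × Bool × Bool)

atTop : ℕ → ℕ → ℕ → ℕ
atTop r v = when (v ≡ᵇ r)

-- A profile ((p , q , w) , (bx , bxy , byz)) records the ranks of a triple x, y, z and whether
-- 0̂ < x, x < y, y < z. chainₛ is the contribution of the chain of length s starting 0̂ < x < ⋯;
-- for s < 3 it is counted only at the triple padded with 1̂, the unique element of rank r.
module _ (r j : ℕ) where

  chain₀ chain₁ chain₂ chain₃ : Profile → ℕ
  chain₀ ((p , q , w) , _)               = atTop r w (atTop r q (atTop r p (1ₚ j)))
  chain₁ ((p , q , w) , (bx , _ , _))     = atTop r w (atTop r q (when (bx ∧ true) (factorProduct (p ∷ []) j)))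
  chain₂ ((p , q , w) , (bx , bxy , _))   = atTop r w (when (bx ∧ bxy ∧ true) (factorProduct (p ∷ q ∸ p ∷ []) j))
  chain₃ ((p , q , w) , (bx , bxy , byz)) =
    when (bx ∧ bxy ∧ byz ∧ true) (factorProduct (p ∷ q ∸ p ∷ w ∸ q ∷ []) j)

  profileCoeff : Profile → ℕ
  profileCoeff π = chain₀ π + (chain₁ π + (chain₂ π + chain₃ π))

-- The last two conditions hold for actual triples because 1̂ is the only element of rank r.
Admissible : ℕ → Profile → Set
Admissible r ((p , q , w) , (bx , bxy , byz)) =
  bx ≡ (0 <ᵇ p) × (T bxy → p < q) × (T byz → q < w) × (q ≡ r → bxy ≡ (p <ᵇ r)) × (w ≡ r → byz ≡ (q <ᵇ r))

admissible? : ∀ r π → Dec (Admissible r π)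
admissible? r ((p , q , w) , (bx , bxy , byz)) =
  bx Bool.≟ (0 <ᵇ p) ×-dec (T? bxy →-dec p <? q) ×-dec (T? byz →-dec q <? w)
  ×-dec (q ≟ r →-dec bxy Bool.≟ (p <ᵇ r)) ×-dec (w ≟ r →-dec byz Bool.≟ (q <ᵇ r))

bools : List Bool
bools = true ∷ false ∷ []

∈-bools : ∀ b → b ∈ bools
∈-bools true  = here refl
∈-bools false = there (here refl)

profiles : ℕ → List Profile
profiles r = cartesianProduct (cartesianProduct ranks (cartesianProduct ranks ranks))
                              (cartesianProduct bools (cartesianProduct bools bools))
  where ranks = upTo (suc r)

AllAdmissible : ℕ → (Profile → Set) → Set
AllAdmissible r Q = All (λ π → Admissible r π → Q π) (profiles r)

PalindromicAt UnimodalAt : ℕ → Profile → Set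
PalindromicAt r π = ∀ {i} → i < r → profileCoeff r i π ≤ profileCoeff r (r ∸ suc i) π
UnimodalAt    r π = 4 ≤ r → profileCoeff r 1 π ≤ profileCoeff r 2 π

certificate : ∀ {r} → r < 7 → AllAdmissible r (λ π → PalindromicAt r π × UnimodalAt r π)
certificate = from-yes (allUpTo? certified? 7)
  where
  palindromicAt? : ∀ r π → Dec (PalindromicAt r π)
  palindromicAt? r π = allUpTo? (λ i → profileCoeff r i π ≤? profileCoeff r (r ∸ suc i) π) r

  unimodalAt? : ∀ r π → Dec (UnimodalAt r π)
  unimodalAt? r π = 4 ≤? r →-dec profileCoeff r 1 π ≤? profileCoeff r 2 π

  certified? : ∀ r → Dec (AllAdmissible r (λ π → PalindromicAt r π × UnimodalAt r π))
  certified? r = All.all? (λ π → admissible? r π →-dec palindromicAt? r π ×-dec unimodalAt? r π) (profiles r)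

-- Chains in a weakly ranked poset

module _ {n : ℕ} (P : WeaklyRankedPoset n) where
  open WeaklyRankedPoset P

  _<Pᵇ_ : Fin n → Fin n → Bool
  x <Pᵇ y = does (<P-dec x y)

  <Pᵇ-reflects : ∀ {x y} b → (T b → x <P y) → (x <P y → T b) → (x <Pᵇ y) ≡ b
  <Pᵇ-reflects b to from = det (proof (<P-dec _ _)) (fromEquivalence to from)

  <Pᵇ-sound : ∀ {x y} → T (x <Pᵇ y) → x <P y
  <Pᵇ-sound {x} {y} = does-sound (<P-dec x y)

  <Pᵇ-complete : ∀ {x y} → x <P y → T (x <Pᵇ y)
  <Pᵇ-complete {x} {y} x<y = Equivalence.from Bool.T-≡ (dec-true (<P-dec x y) x<y)

  <Pᵇ-irrefl : ∀ x → (x <Pᵇ x) ≡ false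
  <Pᵇ-irrefl x = dec-false (<P-dec x x) (λ x<x → proj₂ x<x refl)

  rk-bot : rk bot ≡ 0
  rk-bot with ρ bot bot in eq
  ... | zero  = refl
  ... | suc _ = ⊥-elim (proj₂ (Equivalence.to (ρ-pos bot bot) (subst (0 <_) (sym eq) z<s)) refl)

  rk-add : ∀ {x y} → x ≤P y → rk y ≡ rk x + ρ x y
  rk-add {x} {y} x≤y = ρ-add bot x y (bot-least x) x≤y

  rk-< : ∀ {x y} → x <P y → rk x < rk y
  rk-< {x} {y} x<y = begin-strict
    rk x          ≡⟨ +-identityʳ (rk x) ⟨
    rk x + 0      <⟨ +-monoʳ-< (rk x) (Equivalence.from (ρ-pos x y) x<y) ⟩
    rk x + ρ x y  ≡⟨ rk-add (proj₁ x<y) ⟨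
    rk y          ∎
    where open ≤-Reasoning

  rk≤weakRank : ∀ x → rk x ≤ weakRank
  rk≤weakRank x = subst (rk x ≤_) (sym (rk-add (top-greatest x))) (m≤m+n (rk x) (ρ x top))

  ≡top-of-rk : ∀ x → rk x ≡ weakRank → x ≡ top
  ≡top-of-rk x rk≡r with x Fin.≟ top
  ... | yes x≡top = x≡top
  ... | no  x≢top = ⊥-elim (<-irrefl rk≡r (rk-< (top-greatest x , x≢top)))

  bot<Pᵇ : ∀ x → (bot <Pᵇ x) ≡ (0 <ᵇ rk x)
  bot<Pᵇ x = <Pᵇ-reflects (0 <ᵇ rk x)
    (Equivalence.to (ρ-pos bot x) ∘ <ᵇ⇒< 0 (rk x)) (<⇒<ᵇ ∘ Equivalence.from (ρ-pos bot x))

  bot<Pᵇ-of-< : ∀ {x y} → x <P y → (bot <Pᵇ y) ≡ true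
  bot<Pᵇ-of-< {x} {y} x<y = trans (bot<Pᵇ y) (<⇒<ᵇ≡true (≤-<-trans z≤n (rk-< x<y)))

  <Pᵇ-top : ∀ x → (x <Pᵇ top) ≡ (rk x <ᵇ weakRank)
  <Pᵇ-top x = <Pᵇ-reflects (rk x <ᵇ weakRank)
    (λ t → top-greatest x , λ x≡top → <-irrefl (cong rk x≡top) (<ᵇ⇒< (rk x) weakRank t))
    (<⇒<ᵇ ∘ rk-<)

  isChain : Fin n → List (Fin n) → Bool
  isChain x []      = true
  isChain x (y ∷ l) = (x <Pᵇ y) ∧ isChain y l

  gaps : Fin n → List (Fin n) → List ℕ
  gaps x []      = []
  gaps x (y ∷ l) = rk y ∸ rk x ∷ gaps y l

  length-gaps : ∀ x l → length (gaps x l) ≡ length l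
  length-gaps x []      = refl
  length-gaps x (y ∷ l) = cong suc (length-gaps y l)

  sum-gaps-≤ : ∀ x l → T (isChain x l) → rk x + sum (gaps x l) ≤ weakRank
  sum-gaps-≤ x []      _     = subst (_≤ weakRank) (sym (+-identityʳ (rk x))) (rk≤weakRank x)
  sum-gaps-≤ x (y ∷ l) chain = begin
    rk x + ((rk y ∸ rk x) + sum (gaps y l))  ≡⟨ +-assoc (rk x) (rk y ∸ rk x) (sum (gaps y l)) ⟨
    rk x + (rk y ∸ rk x) + sum (gaps y l)    ≡⟨ cong (_+ sum (gaps y l)) (m+[n∸m]≡n (<⇒≤ (rk-< x<y))) ⟩
    rk y + sum (gaps y l)                    ≤⟨ sum-gaps-≤ y l (proj₂ c) ⟩
    weakRank                                 ∎
    where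
    open ≤-Reasoning
    c   = Equivalence.to Bool.T-∧ chain
    x<y = <Pᵇ-sound (proj₁ c)

  chainWeight-∷-< : ∀ x y l j → x <P y →
    chainWeight P x (y ∷ l) j ≡ (factor (rk y ∸ rk x) *ₚ chainWeight P y l) j
  chainWeight-∷-< x y l j x<y with <P-dec x y | ≤P-dec y top
  ... | yes _  | yes _    = refl
  ... | yes _  | no y≰top = ⊥-elim (y≰top (top-greatest y))
  ... | no x≮y | _        = ⊥-elim (x≮y x<y)

  chainWeight-∷-≮ : ∀ x y l j → ¬ x <P y → chainWeight P x (y ∷ l) j ≡ 0
  chainWeight-∷-≮ x y l j x≮y with <P-dec x y
  ... | yes x<y = ⊥-elim (x≮y x<y)
  ... | no  _   = refl

  chainWeight-∷ : ∀ x y l j →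
    chainWeight P x (y ∷ l) j ≡ when (x <Pᵇ y) ((factor (rk y ∸ rk x) *ₚ chainWeight P y l) j)
  chainWeight-∷ x y l j with x <Pᵇ y in x<ᵇy
  ... | true  = chainWeight-∷-< x y l j (<Pᵇ-sound (Equivalence.from Bool.T-≡ x<ᵇy))
  ... | false = chainWeight-∷-≮ x y l j (λ x<y → subst T x<ᵇy (<Pᵇ-complete x<y))

  chainWeight-unfold : ∀ x l j → chainWeight P x l j ≡ when (isChain x l) (factorProduct (gaps x l) j)
  chainWeight-unfold x []      j = refl
  chainWeight-unfold x (y ∷ l) j = begin
    chainWeight P x (y ∷ l) j
      ≡⟨ chainWeight-∷ x y l j ⟩
    when (x <Pᵇ y) ((f *ₚ chainWeight P y l) j)
      ≡⟨ cong (when (x <Pᵇ y)) (*ₚ-congʳ f (chainWeight-unfold y l) j) ⟩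
    when (x <Pᵇ y) ((f *ₚ (λ i → when (isChain y l) (factorProduct (gaps y l) i))) j)
      ≡⟨ cong (when (x <Pᵇ y)) (*ₚ-when f (factorProduct (gaps y l)) (isChain y l) j) ⟩
    when (x <Pᵇ y) (when (isChain y l) ((f *ₚ factorProduct (gaps y l)) j))
      ≡⟨ when-∧ (x <Pᵇ y) (isChain y l) _ ⟨
    when (isChain x (y ∷ l)) (factorProduct (gaps x (y ∷ l)) j)
      ∎
    where
    open ≡-Reasoning
    f = factor (rk y ∸ rk x)

  chainWeight-vanish-above : ∀ x l j → 1 ≤ j → weakRank ≤ rk x + j → chainWeight P x l j ≡ 0
  chainWeight-vanish-above x []      (suc j) _ _      = refl
  chainWeight-vanish-above x (y ∷ l) j       _ r≤x+j =
    trans (chainWeight-unfold x (y ∷ l) j) (when-vanish (isChain x (y ∷ l)) λ chain →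
      factorProduct-∷-vanish-above (rk y ∸ rk x) (gaps y l) j
        (+-cancelˡ-≤ (rk x) _ _ (≤-trans (sum-gaps-≤ x (y ∷ l) chain) r≤x+j)))

  chainWeight-vanish-below : ∀ x l j → j < length l → chainWeight P x l j ≡ 0
  chainWeight-vanish-below x l j j<len =
    trans (chainWeight-unfold x l j) (when-vanish (isChain x l) λ _ →
      factorProduct-vanish-below (gaps x l) j (subst (j <_) (sym (length-gaps x l)) j<len))

  chainWeight-vanish-long : ∀ x l j → weakRank < rk x + 2 * length l → chainWeight P x l j ≡ 0
  chainWeight-vanish-long x l j r<x+2len =
    trans (chainWeight-unfold x l j) (when-vanish (isChain x l) λ chain →
      factorProduct-vanish-long (gaps x l) j (+-cancelˡ-< (rk x) _ _ (begin-strict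
        rk x + sum (gaps x l)           ≤⟨ sum-gaps-≤ x l chain ⟩
        weakRank                        <⟨ r<x+2len ⟩
        rk x + 2 * length l             ≡⟨ cong (λ k → rk x + 2 * k) (length-gaps x l) ⟨
        rk x + 2 * length (gaps x l)    ∎)))
    where open ≤-Reasoning

  ∑-lists-suc : ∀ s (f : List (Fin n) → ℕ) → ∑ (lists P (suc s)) f ≡ ∑ (allFin n) (λ x → ∑ (lists P s) (f ∘ (x ∷_)))
  ∑-lists-suc s f = trans (∑-concatMap (allFin n) (λ x → map (x ∷_) (lists P s)) f)
    (∑-cong (allFin n) (λ x → ∑-map (lists P s) (x ∷_) f))

  ∑-lists-vanish : ∀ s {f : List (Fin n) → ℕ} → (∀ l → length l ≡ s → f l ≡ 0) → ∑ (lists P s) f ≡ 0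
  ∑-lists-vanish zero    f≗0 = cong (_+ 0) (f≗0 [] refl)
  ∑-lists-vanish (suc s) f≗0 = trans (∑-lists-suc s _)
    (∑-zero (allFin n) (λ {x} _ → ∑-lists-vanish s (λ l len≡s → f≗0 (x ∷ l) (cong suc len≡s))))

  chainSum : ℕ → Poly
  chainSum s j = ∑ (lists P s) (λ l → chainWeight P bot l j)

  chowPoly-coeff : ∀ j → chowPoly P j ≡ ∑ (upTo (suc n)) (λ s → chainSum s j)
  chowPoly-coeff j = trans (sumₚ-map _ (upTo (suc n)) j)
    (∑-cong (upTo (suc n)) (λ s → sumₚ-map (chainWeight P bot) (lists P s) j))

  chainSum-vanish-above : ∀ s j → 1 ≤ j → weakRank ≤ j → chainSum s j ≡ 0
  chainSum-vanish-above s j 1≤j r≤j = ∑-lists-vanish s (λ l _ →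
    chainWeight-vanish-above bot l j 1≤j (subst (λ b → weakRank ≤ b + j) (sym rk-bot) r≤j))

  chainSum-vanish-below : ∀ s j → j < s → chainSum s j ≡ 0
  chainSum-vanish-below s j j<s = ∑-lists-vanish s (λ l len≡s →
    chainWeight-vanish-below bot l j (subst (j <_) (sym len≡s) j<s))

  chainSum-vanish-long : ∀ s j → weakRank < 2 * s → chainSum s j ≡ 0
  chainSum-vanish-long s j r<2s = ∑-lists-vanish s (λ l len≡s →
    chainWeight-vanish-long bot l j (subst₂ (λ b k → weakRank < b + 2 * k) (sym rk-bot) (sym len≡s) r<2s))

  chainSum-vanish-small : n ≤ 2 → ∀ s j → chainSum (2 + s) j ≡ 0
  chainSum-vanish-small n≤2 s j = ∑-lists-vanish (2 + s) λ
    { (x ∷ y ∷ l) _ → trans (chainWeight-unfold bot (x ∷ y ∷ l) j) (when-vanish _ λ chain →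
        let c₁ = Equivalence.to Bool.T-∧ chain
            c₂ = Equivalence.to Bool.T-∧ (proj₂ c₁)
        in  ⊥-elim (chain-needs-three (<Pᵇ-sound (proj₁ c₁)) (<Pᵇ-sound (proj₁ c₂))))
    ; [] () ; (_ ∷ []) () }
    where
    chain-needs-three : ∀ {x y} → bot <P x → x <P y → ⊥
    chain-needs-three {x} {y} (_ , bot≢x) (x≤y , x≢y) = no-three-distinct n≤2 bot x y bot≢x x≢y
      (λ bot≡y → x≢y (≤P-antisym x≤y (subst (_≤P x) bot≡y (bot-least x))))

  chow₃ : Poly
  chow₃ j = ∑ (upTo 4) (λ s → chainSum s j)

  -- The defining sum stops at length n; when n ≤ 2 this may be below 3, but then chains of length
  -- at least 2 would need three distinct elements.
  chowPoly≡chow₃ : weakRank ≤ 6 → ∀ j → chowPoly P j ≡ chow₃ j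
  chowPoly≡chow₃ r≤6 j with n ≤? 2
  ... | no  n≰2 = trans (chowPoly-coeff j) (∑-upTo-truncate {4} {suc n} cs long (s≤s (≰⇒> n≰2)))
    where
    cs = λ s → chainSum s j
    long : ∀ s → 4 ≤ s → chainSum s j ≡ 0
    long s 4≤s = chainSum-vanish-long s j (<-≤-trans (s≤s (≤-trans r≤6 (n≤1+n 6))) (*-monoʳ-≤ 2 4≤s))
  ... | yes n≤2 = trans (chowPoly-coeff j) (trans (∑-upTo-truncate {2} {suc n} cs short 2≤1+n)
                                                  (sym (∑-upTo-truncate {2} {4} cs short (s≤s (s≤s z≤n)))))
    where
    cs = λ s → chainSum s j
    2≤1+n = s≤s (>-nonZero⁻¹ n {{Fin.nonZeroIndex bot}})
    short : ∀ s → 2 ≤ s → chainSum s j ≡ 0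
    short 1             (s≤s ())
    short (suc (suc s)) _ = chainSum-vanish-small n≤2 s j

  chow₃-0 : chow₃ 0 ≡ 1
  chow₃-0 = cong suc (cong₂ _+_ (below 0) (cong₂ _+_ (below 1) (cong (_+ 0) (below 2))))
    where
    below : ∀ s → chainSum (suc s) 0 ≡ 0
    below s = chainSum-vanish-below (suc s) 0 z<s

  chow₃-vanish : ∀ j → 1 ≤ j → weakRank ≤ j → chow₃ j ≡ 0
  chow₃-vanish j 1≤j r≤j = ∑-zero (upTo 4) (λ {s} _ → chainSum-vanish-above s j 1≤j r≤j)

  ∑-lists-1 : ∀ f → ∑ (lists P 1) f ≡ ∑ (allFin n) (λ x → f (x ∷ []))
  ∑-lists-1 f = trans (∑-lists-suc 0 f) (∑-cong (allFin n) (λ x → +-identityʳ (f (x ∷ []))))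

  ∑-lists-2 : ∀ f → ∑ (lists P 2) f ≡ ∑ (allFin n) (λ x → ∑ (allFin n) (λ y → f (x ∷ y ∷ [])))
  ∑-lists-2 f = trans (∑-lists-suc 1 f) (∑-cong (allFin n) (λ x → ∑-lists-1 (f ∘ (x ∷_))))

  ∑-lists-3 : ∀ f → ∑ (lists P 3) f ≡
              ∑ (allFin n) (λ x → ∑ (allFin n) (λ y → ∑ (allFin n) (λ z → f (x ∷ y ∷ z ∷ []))))
  ∑-lists-3 f = trans (∑-lists-suc 2 f) (∑-cong (allFin n) (λ x → ∑-lists-2 (f ∘ (x ∷_))))

  chainWeight-bot : ∀ x l j →
    chainWeight P bot (x ∷ l) j ≡ when (isChain bot (x ∷ l)) (factorProduct (rk x ∷ gaps x l) j)
  chainWeight-bot x l j = trans (chainWeight-unfold bot (x ∷ l) j)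
    (cong (λ b → when (isChain bot (x ∷ l)) (factorProduct (rk x ∸ b ∷ gaps x l) j)) rk-bot)

  private
    single : ℕ → Fin n → ℕ
    single j x = when (bot <Pᵇ x ∧ true) (factor (rk x) j)

    pair : Fin n → Fin n → ℕ
    pair x y = when (bot <Pᵇ x ∧ x <Pᵇ y ∧ true) (factor (rk x) 1 * factor (rk y ∸ rk x) 1)

    chainSum-1 : ∀ j → chainSum 1 j ≡ ∑ (allFin n) (single j)
    chainSum-1 j = trans (∑-lists-1 _) (∑-cong (allFin n) λ x →
      trans (chainWeight-bot x [] j) (cong (when _) (factorProduct-[ rk x ] j)))

    chainSum-2-2 : chainSum 2 2 ≡ ∑ (allFin n) (λ x → ∑ (allFin n) (pair x))
    chainSum-2-2 = trans (∑-lists-2 _) (∑-cong (allFin n) λ x → ∑-cong (allFin n) λ y →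
      trans (chainWeight-bot x (y ∷ []) 2) (cong (when _) (factorProduct-pair-2 (rk x) (rk y ∸ rk x))))

    diagonal : ∀ x c → ∑ (allFin n) (λ y → when (does (y Fin.≟ x)) c) ≡ c
    diagonal x c = trans (∑-allFin-single _ x (λ y y≢x → cong (λ b → when b c) (dec-false (y Fin.≟ x) y≢x)))
                         (cong (λ b → when b c) (dec-true (x Fin.≟ x) refl))

    pair-bound : ∀ x y → when (does (y Fin.≟ x)) (single 2 x) + pair x y ≤ single 1 x * single 1 y
    pair-bound x y with y Fin.≟ x
    ... | yes refl with bot <Pᵇ x
    ...   | false = z≤n
    ...   | true rewrite <Pᵇ-irrefl x =
      ≤-trans (≤-reflexive (+-identityʳ (factor (rk x) 2)))
              (≤-trans (factor-antitoneʳ (rk x) 0) (m≤m*m (factor (rk x) 1)))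
    pair-bound x y | no _ with bot <Pᵇ x | x <Pᵇ y in x<ᵇy
    ...   | false | _     = z≤n
    ...   | true  | false = z≤n
    ...   | true  | true  rewrite bot<Pᵇ-of-< (<Pᵇ-sound (Equivalence.from Bool.T-≡ x<ᵇy)) =
      *-monoʳ-≤ (factor (rk x) 1) (factor-monoˡ-≤ (m∸n≤m (rk y) (rk x)) 1)

  chow₃-2≤1² : chow₃ 2 ≤ chow₃ 1 * chow₃ 1
  chow₃-2≤1² = begin
    chow₃ 2
      ≡⟨ chow₃-2 ⟩
    ∑ all (single 2) + ∑ all (λ x → ∑ all (pair x))
      ≡⟨ cong (_+ ∑ all (λ x → ∑ all (pair x))) (∑-cong all λ x → diagonal x (single 2 x)) ⟨
    ∑ all (λ x → ∑ all (λ y → when (does (y Fin.≟ x)) (single 2 x))) + ∑ all (λ x → ∑ all (pair x))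
      ≡⟨ trans (∑-cong all λ x → ∑-distrib-+ all _ (pair x)) (∑-distrib-+ all _ _) ⟨
    ∑ all (λ x → ∑ all (λ y → when (does (y Fin.≟ x)) (single 2 x) + pair x y))
      ≤⟨ ∑-mono-≤ all (λ x → ∑-mono-≤ all (pair-bound x)) ⟩
    ∑ all (λ x → ∑ all (λ y → single 1 x * single 1 y))
      ≡⟨ trans (∑-distribʳ-* all _ _) (∑-cong all λ x → ∑-distribˡ-* all (single 1 x) (single 1)) ⟨
    ∑ all (single 1) * ∑ all (single 1)
      ≡⟨ cong₂ _*_ chow₃-1 chow₃-1 ⟨
    chow₃ 1 * chow₃ 1
      ∎
    where
    open ≤-Reasoning
    all = allFin n
    chow₃-1 : chow₃ 1 ≡ ∑ all (single 1)
    chow₃-1 = trans (cong (chainSum 1 1 +_) (cong₂ _+_ (chainSum-vanish-below 2 1 ≤-refl)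
                                                  (cong (_+ 0) (chainSum-vanish-below 3 1 (s≤s (s≤s z≤n))))))
                    (trans (+-identityʳ _) (chainSum-1 1))

    chow₃-2 : chow₃ 2 ≡ ∑ all (single 2) + ∑ all (λ x → ∑ all (pair x))
    chow₃-2 = cong₂ _+_ (chainSum-1 2)
      (trans (cong₂ _+_ chainSum-2-2 (cong (_+ 0) (chainSum-vanish-below 3 2 ≤-refl))) (+-identityʳ _))

  profile : Fin n → Fin n → Fin n → Profile
  profile x y z = (rk x , rk y , rk z) , (bot <Pᵇ x , x <Pᵇ y , y <Pᵇ z)

  ∑³ : (Fin n → Fin n → Fin n → ℕ) → ℕ
  ∑³ f = ∑ (allFin n) λ x → ∑ (allFin n) λ y → ∑ (allFin n) λ z → f x y z

  ∑³-distrib-+ : ∀ f g → ∑³ (λ x y z → f x y z + g x y z) ≡ ∑³ f + ∑³ g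
  ∑³-distrib-+ f g = trans
    (∑-cong (allFin n) λ x → trans (∑-cong (allFin n) λ y → ∑-distrib-+ (allFin n) (f x y) (g x y))
                                   (∑-distrib-+ (allFin n) _ _))
    (∑-distrib-+ (allFin n) _ _)

  ∑-atTop : ∀ c → ∑ (allFin n) (λ z → atTop weakRank (rk z) c) ≡ c
  ∑-atTop c = trans (∑-allFin-single _ top (λ y y≢top → cong (λ b → when b c) (off-top y y≢top)))
                    (cong (λ b → when b c) (Equivalence.to Bool.T-≡ (≡⇒≡ᵇ weakRank weakRank refl)))
    where
    off-top : ∀ y → y ≢ top → (rk y ≡ᵇ weakRank) ≡ false
    off-top y y≢top with rk y ≡ᵇ weakRank in eq
    ... | true  = ⊥-elim (y≢top (≡top-of-rk y (≡ᵇ⇒≡ (rk y) weakRank (Equivalence.from Bool.T-≡ eq))))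
    ... | false = refl

  chow₃≡∑³ : ∀ j → chow₃ j ≡ ∑³ (λ x y z → profileCoeff weakRank j (profile x y z))
  chow₃≡∑³ j = begin
    chow₃ j
      ≡⟨ cong (λ t → chainSum 0 j + (chainSum 1 j + (chainSum 2 j + t))) (+-identityʳ (chainSum 3 j)) ⟩
    chainSum 0 j + (chainSum 1 j + (chainSum 2 j + chainSum 3 j))
      ≡⟨ cong₂ _+_ chainSum₀≡ (cong₂ _+_ chainSum₁≡ (cong₂ _+_ chainSum₂≡ chainSum₃≡)) ⟩
    ∑³ (c chain₀) + (∑³ (c chain₁) + (∑³ (c chain₂) + ∑³ (c chain₃)))
      ≡⟨ trans (∑³-distrib-+ _ _) (cong (∑³ (c chain₀) +_)
           (trans (∑³-distrib-+ _ _) (cong (∑³ (c chain₁) +_) (∑³-distrib-+ _ _)))) ⟨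
    ∑³ (λ x y z → profileCoeff weakRank j (profile x y z))
      ∎
    where
    open ≡-Reasoning
    all = allFin n

    c : (ℕ → ℕ → Profile → ℕ) → Fin n → Fin n → Fin n → ℕ
    c chain x y z = chain weakRank j (profile x y z)

    collapse² : ∀ v → ∑ all (λ y → ∑ all (λ z → atTop weakRank (rk z) (atTop weakRank (rk y) v))) ≡ v
    collapse² v = trans (∑-cong all λ y → ∑-atTop _) (∑-atTop v)

    chainSum₀≡ : chainSum 0 j ≡ ∑³ (c chain₀)
    chainSum₀≡ = trans (+-identityʳ (1ₚ j)) (sym (trans (∑-cong all λ x → collapse² _) (∑-atTop (1ₚ j))))

    chainSum₁≡ : chainSum 1 j ≡ ∑³ (c chain₁)
    chainSum₁≡ = trans (∑-lists-1 _) (∑-cong all λ x → trans (chainWeight-bot x [] j) (sym (collapse² _)))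

    chainSum₂≡ : chainSum 2 j ≡ ∑³ (c chain₂)
    chainSum₂≡ = trans (∑-lists-2 _) (∑-cong all λ x → ∑-cong all λ y →
      trans (chainWeight-bot x (y ∷ []) j) (sym (∑-atTop _)))

    chainSum₃≡ : chainSum 3 j ≡ ∑³ (c chain₃)
    chainSum₃≡ = trans (∑-lists-3 _) (∑-cong all λ x → ∑-cong all λ y → ∑-cong all λ z →
      chainWeight-bot x (y ∷ z ∷ []) j)

  profile-admissible : ∀ x y z → Admissible weakRank (profile x y z)
  profile-admissible x y z = bot<Pᵇ x , rk-<ᵇ , rk-<ᵇ , at-top y x , at-top z y
    where
    rk-<ᵇ : ∀ {a b} → T (a <Pᵇ b) → rk a < rk b
    rk-<ᵇ = rk-< ∘ <Pᵇ-sound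
    at-top : ∀ b a → rk b ≡ weakRank → (a <Pᵇ b) ≡ (rk a <ᵇ weakRank)
    at-top b a rk≡r rewrite ≡top-of-rk b rk≡r = <Pᵇ-top a

  profile-∈ : ∀ x y z → profile x y z ∈ profiles weakRank
  profile-∈ x y z =
    ∈-cartesianProduct⁺ (∈-cartesianProduct⁺ (rank-∈ x) (∈-cartesianProduct⁺ (rank-∈ y) (rank-∈ z)))
                        (∈-cartesianProduct⁺ (∈-bools _) (∈-cartesianProduct⁺ (∈-bools _) (∈-bools _)))
    where
    rank-∈ : ∀ x → rk x ∈ upTo (suc weakRank)
    rank-∈ x = ∈-upTo⁺ (s≤s (rk≤weakRank x))

  allAdmissible-profile : ∀ {Q} → AllAdmissible weakRank Q → ∀ x y z → Q (profile x y z)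
  allAdmissible-profile all x y z = All.lookup all (profile-∈ x y z) (profile-admissible x y z)

  chow₃-mono-≤ : ∀ i j →
    (∀ x y z → profileCoeff weakRank i (profile x y z) ≤ profileCoeff weakRank j (profile x y z)) →
    chow₃ i ≤ chow₃ j
  chow₃-mono-≤ i j le = subst₂ _≤_ (sym (chow₃≡∑³ i)) (sym (chow₃≡∑³ j))
    (∑-mono-≤ (allFin n) λ x → ∑-mono-≤ (allFin n) λ y → ∑-mono-≤ (allFin n) λ z → le x y z)

  chow₃-palindromic : weakRank ≤ 6 → Palindromic weakRank chow₃
  chow₃-palindromic r≤6 = palindromic-from-≤ weakRank chow₃ λ i i<r →
    chow₃-mono-≤ i _ λ x y z → proj₁ (allAdmissible-profile (certificate (s≤s r≤6)) x y z) i<r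

  chow₃-unimodal : weakRank ≤ 6 → 4 ≤ weakRank → chow₃ 1 ≤ chow₃ 2
  chow₃-unimodal r≤6 4≤r =
    chow₃-mono-≤ 1 2 λ x y z → proj₂ (allAdmissible-profile (certificate (s≤s r≤6)) x y z) 4≤r

theorem6p2 : (n : ℕ) (P : WeaklyRankedPoset n) →
    WeaklyRankedPoset.weakRank P ≤ 6 → LogConcave (chowPoly P)
theorem6p2 n P r≤6 = LogConcave-cong (chowPoly≡chow₃ P r≤6)
  (logConcave-of-shape (chow₃-0 P) (chow₃-2≤1² P) (WeaklyRankedPoset.weakRank P) r≤6
    (chow₃-vanish P) (chow₃-palindromic P r≤6) (chow₃-unimodal P r≤6))
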